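{- Let $T$ be a finite tree of diameter $d$. Adversary can force an Agents win of $\text{BROADCAST}(T,2)$ to take at least time $d/2$.
   Context: For a finite connected graph $G$ and an integer $k\ge 1$, $\text{BROADCAST}(G,k)$ is a game between a team of $k$ agents ("Agents") and "Adversary". Setup: Adversary places $k-1$ ignorant agents and $1$ knowledgeable agent on $k$ distinct vertices of $G$. At each time $t=1,2,\ldots$: first Adversary selects an arbitrary connected spanning subgraph $G_t$ of $G$; then each agent either stays at its vertex or moves to a vertex adjacent to it in $G_t$. If after this move several agents are located at the same vertex and at least one of them was knowledgeable at time $t-1$, all of them become knowledgeable at time $t$. Agents win once all agents are knowledgeable; time is measured in rounds. -}

module Defs where

open import Level using (0ℓ)
open import Data.Nat using (ℕ; zero; suc; _≤_; _<_; _*_)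
open import Data.Fin using (Fin)
open import Data.Bool using (Bool; true; false; _∨_)
open import Data.List using (List; []; _∷_; _++_; length)
open import Data.List.Relation.Unary.Unique.Propositional using (Unique)
open import Data.Product using (Σ; ∃; ∃-syntax; _×_; _,_)
open import Data.Sum using (_⊎_)
open import Relation.Nullary using (¬_)
open import Relation.Binary.PropositionalEquality using (_≡_; _≢_)

record Graph (n : ℕ) : Set₁ where
  field
    Adj    : Fin n → Fin n → Set
    sym    : ∀ {u v} → Adj u v → Adj v u
    irrefl : ∀ {u} → ¬ Adj u u
open Graph public

data Walk {n : ℕ} (G : Graph n) : Fin n → Fin n → ℕ → Set where
  here  : ∀ {u} → Walk G u u zero
  there : ∀ {u v w m} → Adj G u v → Walk G v w m → Walk G u w (suc m)

Connected : ∀ {n} → Graph n → Set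
Connected G = ∀ u v → ∃[ m ] Walk G u v m

data Chain {n : ℕ} (G : Graph n) : List (Fin n) → Set where
  nil  : Chain G []
  one  : ∀ {x} → Chain G (x ∷ [])
  cons : ∀ {x y xs} → Adj G x y → Chain G (y ∷ xs) → Chain G (x ∷ y ∷ xs)

Cycle : ∀ {n} → Graph n → Set
Cycle {n} G = Σ (Fin n) λ x → Σ (List (Fin n)) λ xs →
  (2 ≤ length xs) × Unique (x ∷ xs) × Chain G (x ∷ xs ++ x ∷ [])

IsTree : ∀ {n} → Graph n → Set
IsTree G = Connected G × ¬ Cycle G

-- G has diameter d: d is the maximum over pairs u,v of dist(u,v)
-- (dist = length of a shortest walk)
HasDiameter : ∀ {n} → Graph n → ℕ → Set
HasDiameter G d =
  (∀ u v → ∃[ m ] (m ≤ d × Walk G u v m)) ×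
  (∃[ u ] ∃[ v ] (Walk G u v d × (∀ m → Walk G u v m → d ≤ m)))

record SpanningConnSub {n : ℕ} (G : Graph n) : Set₁ where
  field
    graph     : Graph n
    sub       : ∀ {u v} → Adj graph u v → Adj G u v
    connected : Connected graph
open SpanningConnSub public

record State (n k : ℕ) : Set where
  constructor ⟨_,_⟩
  field
    pos  : Fin k → Fin n
    know : Fin k → Bool
open State public

LegalMove : ∀ {n k} → Graph n → (Fin k → Fin n) → (Fin k → Fin n) → Set
LegalMove H p p' = ∀ i → p' i ≡ p i ⊎ Adj H (p i) (p' i)

data Informed {n k : ℕ} (p' : Fin k → Fin n) (kn : Fin k → Bool) (i : Fin k) : Set where
  self  : kn i ≡ true → Informed p' kn i
  meets : ∀ j → p' j ≡ p' i → kn j ≡ true → Informed p' kn i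

UpdatedKnow : ∀ {n k} → (Fin k → Fin n) → (Fin k → Bool) → (Fin k → Bool) → Set
UpdatedKnow p' kn kn' = ∀ i → (kn' i ≡ true → Informed p' kn i) × (Informed p' kn i → kn' i ≡ true)

AllKnow : ∀ {n k} → State n k → Set
AllKnow s = ∀ i → know s i ≡ true

ValidStart : ∀ {n k} → State n k → Set
ValidStart {k = k} s =
  (∀ i j → pos s i ≡ pos s j → i ≡ j) ×
  (Σ (Fin k) λ i → know s i ≡ true × (∀ j → j ≢ i → know s j ≡ false))

-- AdvHolds G t s : starting from state s (at time t₀), Adversary has a strategy
-- guaranteeing that the agents are NOT all knowledgeable at any of the times
-- t₀, t₀+1, …, t₀+t, whatever the agents do.
data AdvHolds {n k : ℕ} (G : Graph n) : ℕ → State n k → Set₁ where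
  base : ∀ {s} → ¬ AllKnow s → AdvHolds G zero s
  step : ∀ {t s} → ¬ AllKnow s →
         (H : SpanningConnSub G) →
         (∀ p' kn' → LegalMove (graph H) (pos s) p' → UpdatedKnow p' (know s) kn' →
            AdvHolds G t ⟨ p' , kn' ⟩) →
         AdvHolds G (suc t) s

-- Adversary can force every Agents win of BROADCAST(G,k) to take at least time T:
-- there is a valid placement from which Adversary can keep the agents from
-- winning at every time t < T.  (T given as a rational d/2 via 2t < d.)
AdvForcesAtLeastHalf : ∀ {n} → Graph n → (k d : ℕ) → Set₁
AdvForcesAtLeastHalf {n} G k d =
  Σ (State n k) λ s → ValidStart s × (∀ t → 2 * t < d → AdvHolds G t s)

{-# OPTIONS --safe #-}
-- Adversary never deletes an edge (every round graph is T itself) and places the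
-- two agents at the ends of a diametral path, the knowledgeable one at one end.
-- In one round each agent moves along at most one edge, so the distance between
-- them drops by at most 2; while it stays positive they never share a vertex and
-- the ignorant agent stays ignorant.  Hence no win happens before time d/2.
module Submission where

open import Defs
open import Data.Nat using (ℕ; zero; suc; _≤_; _*_; z≤n; s≤s; s≤s⁻¹)
open import Data.Nat.Properties using (≤-trans; <⇒≤; *-suc)
open import Data.Fin using (Fin)
open import Data.Fin.Patterns using (0F; 1F)
open import Data.Bool using (Bool; true; false)
open import Data.Bool.Properties using (¬-not; not-¬)
open import Data.Product using (Σ; _×_; _,_; proj₁)
open import Data.Sum using (_⊎_; inj₁; inj₂)
open import Relation.Nullary using (¬_; contradiction)
open import Relation.Binary.PropositionalEquality using (_≡_; _≢_; refl; subst; ≢-sym)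

FarApart : ∀ {n} → Graph n → ℕ → Fin n → Fin n → Set
FarApart G c u v = ∀ m → Walk G u v m → c ≤ m

module _ {n : ℕ} {G : Graph n} where

  walk-snoc : ∀ {u v w m} → Walk G u v m → Adj G v w → Walk G u w (suc m)
  walk-snoc here         e = there e here
  walk-snoc (there e′ q) e = there e′ (walk-snoc q e)

  farApart-≤ : ∀ {c c′ u v} → c ≤ c′ → FarApart G c′ u v → FarApart G c u v
  farApart-≤ c≤c′ far m q = ≤-trans c≤c′ (far m q)

  farApart-distinct : ∀ {c u v} → FarApart G (suc c) u v → u ≢ v
  farApart-distinct far refl with far 0 here
  ... | ()

  farApart-moveˡ : ∀ {c u u′ v} → FarApart G (suc c) u v →
                   u′ ≡ u ⊎ Adj G u u′ → FarApart G c u′ v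
  farApart-moveˡ far (inj₁ refl) m q = <⇒≤ (far m q)
  farApart-moveˡ far (inj₂ e)    m q = s≤s⁻¹ (far (suc m) (there e q))

  farApart-moveʳ : ∀ {c u v v′} → FarApart G (suc c) u v →
                   v′ ≡ v ⊎ Adj G v v′ → FarApart G c u v′
  farApart-moveʳ far (inj₁ refl) m q = <⇒≤ (far m q)
  farApart-moveʳ far (inj₂ e)    m q = s≤s⁻¹ (far (suc m) (walk-snoc q (sym G e)))

  farApart-move : ∀ {c u u′ v v′} → FarApart G (suc (suc c)) u v →
                  u′ ≡ u ⊎ Adj G u u′ → v′ ≡ v ⊎ Adj G v v′ → FarApart G c u′ v′
  farApart-move far mu mv = farApart-moveʳ (farApart-moveˡ far mu) mv

  spanning-self : Connected G → SpanningConnSub G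
  spanning-self connected = record { graph = G ; sub = λ e → e ; connected = connected }

  distant-pair : ∀ {d} → 2 ≤ n → HasDiameter G d →
                 Σ (Fin n) λ u → Σ (Fin n) λ v → FarApart G d u v × u ≢ v
  -- For d = 0 any two vertices will do; only then is 2 ≤ n needed.
  distant-pair {zero}  (s≤s (s≤s _)) _ = 0F , 1F , (λ _ _ → z≤n) , λ ()
  distant-pair {suc d} _ (_ , u , v , _ , far) = u , v , far , farApart-distinct far

module _ {n k : ℕ} where

  ignorant-not-allKnow : ∀ (s : State n k) i → know s i ≡ false → ¬ AllKnow s
  ignorant-not-allKnow _ i ignorant allKnow = not-¬ ignorant (allKnow i)

  stays-ignorant : ∀ {p′ : Fin k → Fin n} {kn kn′ i} → kn i ≡ false →
                   (∀ j → kn j ≡ true → p′ j ≢ p′ i) →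
                   UpdatedKnow p′ kn kn′ → kn′ i ≡ false
  stays-ignorant {kn′ = kn′} {i} ignorant unmet updated = ¬-not not-informed
    where
    not-informed : kn′ i ≢ true
    not-informed knows with proj₁ (updated i) knows
    ... | self k         = not-¬ ignorant k
    ... | meets j same k = unmet j k same

start : ∀ {n} → Fin n → Fin n → State n 2
start u v = ⟨ position , knowledge ⟩
  where
  position : Fin 2 → Fin _
  position 0F = u
  position 1F = v
  knowledge : Fin 2 → Bool
  knowledge 0F = true
  knowledge 1F = false

start-valid : ∀ {n} {u v : Fin n} → u ≢ v → ValidStart (start u v)
start-valid {u = u} {v} u≢v = injective , 0F , refl , only-0F
  where
  injective : ∀ i j → pos (start u v) i ≡ pos (start u v) j → i ≡ j
  injective 0F 0F _ = refl
  injective 0F 1F e = contradiction e u≢v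
  injective 1F 0F e = contradiction e (≢-sym u≢v)
  injective 1F 1F _ = refl
  only-0F : ∀ j → j ≢ 0F → know (start u v) j ≡ false
  only-0F 0F j≢0 = contradiction refl j≢0
  only-0F 1F _   = refl

module _ {n : ℕ} (G : Graph n) (connected : Connected G) where

  adversary-holds : ∀ t {s : State n 2} →
                    FarApart G (suc (2 * t)) (pos s 0F) (pos s 1F) →
                    know s 1F ≡ false → AdvHolds G t s
  adversary-holds zero    {s} _   ignorant = base (ignorant-not-allKnow s 1F ignorant)
  adversary-holds (suc t) {s} far ignorant =
    step (ignorant-not-allKnow s 1F ignorant) (spanning-self connected)
      λ p′ kn′ legal updated →
        let far+2 : FarApart G (suc (suc (suc (2 * t)))) (pos s 0F) (pos s 1F)
            far+2 = subst (λ c → FarApart G (suc c) (pos s 0F) (pos s 1F)) (*-suc 2 t) far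
            far′  = farApart-move far+2 (legal 0F) (legal 1F)
            unmet : ∀ j → know s j ≡ true → p′ j ≢ p′ 1F
            unmet = λ { 0F _ → farApart-distinct far′
                      ; 1F k → contradiction k (not-¬ ignorant) }
        in adversary-holds t far′ (stays-ignorant ignorant unmet updated)

mainTheorem10 : (n : ℕ) → 2 ≤ n → (T : Graph n) → IsTree T →
    (d : ℕ) → HasDiameter T d → AdvForcesAtLeastHalf T 2 d
mainTheorem10 n 2≤n T (connected , _) d diameter
  with distant-pair 2≤n diameter
... | u , v , far , u≢v =
  start u v , start-valid u≢v ,
  λ t 2t<d → adversary-holds T connected t (farApart-≤ 2t<d far) refl
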